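{- There is an infinite family of connected vertex transitive graphs whose number of minimal zero forcing sets is exponential in the number of vertices $n$, and there is an infinite family of connected vertex transitive graphs whose number of minimal zero forcing sets is polynomial in $n$.
   Context: All graphs are finite, simple and undirected. A graph is vertex transitive if for any two vertices $v_1,v_2$ there is an automorphism mapping $v_1$ to $v_2$. Given a set $S$ of initially blue vertices (all others white), the zero forcing color change rule says that a blue vertex with exactly one white neighbor causes that neighbor to become blue. $S$ is a zero forcing set if repeatedly applying this rule eventually makes every vertex blue. A minimal zero forcing set is a zero forcing set containing no other zero forcing set as a proper subset. -}

module Defs where

open import Data.Nat using (ℕ; _≤_; _*_; _^_; _<_)
open import Data.Bool using (Bool; true; false)
open import Data.Fin using (Fin)
open import Data.Fin.Subset using (Subset; _∈_; _⊂_)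
open import Data.Fin.Permutation using (Permutation′; _⟨$⟩ʳ_)
open import Data.List using (List; length)
open import Data.List.Relation.Unary.All using (All)
open import Data.List.Relation.Unary.Unique.Propositional using (Unique)
open import Data.Product using (Σ; ∃; _×_; _,_)
open import Relation.Binary.PropositionalEquality using (_≡_; _≢_)
open import Relation.Binary.Construct.Closure.ReflexiveTransitive using (Star)
open import Relation.Nullary using (¬_)

record Graph (n : ℕ) : Set where
  field
    adj   : Fin n → Fin n → Bool
    sym   : ∀ i j → adj i j ≡ adj j i
    irrefl : ∀ i → adj i i ≡ false
open Graph public

Adj : ∀ {n} → Graph n → Fin n → Fin n → Set
Adj G i j = adj G i j ≡ true

IsAutomorphism : ∀ {n} → Graph n → Permutation′ n → Set
IsAutomorphism G σ = ∀ i j → adj G (σ ⟨$⟩ʳ i) (σ ⟨$⟩ʳ j) ≡ adj G i j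

VertexTransitive : ∀ {n} → Graph n → Set
VertexTransitive {n} G =
  (v₁ v₂ : Fin n) → Σ (Permutation′ n) λ σ → IsAutomorphism G σ × (σ ⟨$⟩ʳ v₁ ≡ v₂)

Connected : ∀ {n} → Graph n → Set
Connected {n} G = (u v : Fin n) → Star (Adj G) u v

data Blue {n : ℕ} (G : Graph n) (S : Subset n) : Fin n → Set where
  initial : ∀ {v} → v ∈ S → Blue G S v
  force   : ∀ {u v} → Blue G S u → Adj G u v →
            (∀ w → Adj G u w → w ≢ v → Blue G S w) → Blue G S v

IsZeroForcingSet : ∀ {n} → Graph n → Subset n → Set
IsZeroForcingSet {n} G S = (v : Fin n) → Blue G S v

IsMinimalZeroForcingSet : ∀ {n} → Graph n → Subset n → Set
IsMinimalZeroForcingSet {n} G S =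
  IsZeroForcingSet G S × ((T : Subset n) → T ⊂ S → ¬ IsZeroForcingSet G T)

-- "the number of minimal zero forcing sets of G is at least k":
-- there are k pairwise distinct minimal zero forcing sets.
AtLeastMinZFS : ∀ {n} → Graph n → ℕ → Set
AtLeastMinZFS {n} G k =
  Σ (List (Subset n)) λ Ss →
    Unique Ss × All (IsMinimalZeroForcingSet G) Ss × k ≤ length Ss

-- "the number of minimal zero forcing sets of G is at most k":
-- every list of pairwise distinct minimal zero forcing sets has length ≤ k.
AtMostMinZFS : ∀ {n} → Graph n → ℕ → Set
AtMostMinZFS {n} G k =
  (Ss : List (Subset n)) → Unique Ss → All (IsMinimalZeroForcingSet G) Ss → length Ss ≤ k

-- Minimality is witnessed by forts: if no vertex outside F has exactly one neighbour in F,
-- no vertex of F ever turns blue from a set disjoint from F.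
--
-- Exponential family: the odd cycle Cₘ with every vertex replaced by two non-adjacent twins,
-- on n = 2m vertices.  Take both twins over vertex 0 and one of the two twins over each other
-- vertex of Cₘ; this gives 2^(m-1) distinct sets.  Each is zero forcing: if both twins over i
-- and one twin over i + 2 are blue, a blue vertex over i + 1 forces the other twin over i + 2,
-- so blue twin pairs spread in steps of two and, m being odd, reach every vertex.  Each
-- is minimal: dropping a vertex over i ≠ 0 leaves the twin pair over i as a fort, and dropping
-- a vertex over 0 leaves the white vertices, which lie over every vertex of Cₘ, as a fort
-- (every vertex of Cₘ has two neighbours).  Finally 2^(m-1) ≥ (5/4)^(2m) once m ≥ 3.
--
-- Polynomial family: in Kₙ any two white vertices form a fort, so the minimal zero forcing
-- sets are exactly the n complements of single vertices.

module Submission where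

open import Defs hiding (sym)
open import Data.Nat using (ℕ; zero; suc; _≤_; _<_; _*_; _^_; _+_; _∸_; z≤n; s≤s; _%_)
open import Data.Nat.Properties
  using (≤-trans; ≤-reflexive; ≤ᵇ⇒≤; n≤1+n; m≤m+n; m≤n+m; <⇒≤; m∸n+n≡m; +-suc; +-assoc; +-comm; +-identityʳ;
         *-suc; *-comm; *-identityˡ; *-identityʳ; m≤m*n; *-monoʳ-≤; *-monoˡ-≤; ^-*-assoc; module ≤-Reasoning)
open import Data.Nat.Tactic.RingSolver using (solve-∀)
open import Data.Nat.DivMod
  using (_mod_; m%n<n; m<n⇒m%n≡m; m%n%n≡m%n; %-distribˡ-+; [m+n]%n≡m%n; [m+kn]%n≡m%n)
open import Data.Bool using (true)
open import Data.Unit using (tt)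
open import Data.Fin using (Fin; zero; suc; toℕ; combine; remQuot; opposite)
open import Data.Fin.Properties
  using (_≟_; any?; toℕ-injective; toℕ<n; toℕ-fromℕ<; remQuot-combine; combine-remQuot)
open import Data.Fin.Subset using (Subset; _∈_; _∉_; _⊆_; _⊂_; ∁; ⁅_⁆)
open import Data.Fin.Subset.Properties using (⊆-antisym; x∈⁅x⁆; x∈⁅y⁆⇒x≡y; _∈?_; x∈∁p⇒x∉p; x∉p⇒x∈∁p)
open import Data.Fin.Permutation
  using (Permutation′; _⟨$⟩ʳ_; inverseʳ; flip; transpose; permutation)
open import Data.Vec using (Vec; []; _∷_; lookup; tabulate)
import Data.Vec.Properties as Vec
open import Data.Vec.Properties using (lookup⇒[]=; []=⇒lookup; lookup∘tabulate; tabulate∘lookup; tabulate-cong)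
open import Data.List using (List; []; _∷_; length; _++_; map; allFin)
open import Data.List.Properties using (length-++; length-++-sucʳ; length-map; length-tabulate)
import Data.List.Relation.Unary.All as All
open import Data.List.Relation.Unary.All using ([]) renaming (lookup to lookupAll)
import Data.List.Relation.Unary.All.Properties as All
import Data.List.Relation.Unary.Unique.Propositional.Properties as Unique
open import Data.List.Relation.Binary.Disjoint.Propositional using (Disjoint)
open import Data.List.Relation.Unary.Any using (here; there)
open import Data.List.Relation.Unary.AllPairs using ([]; _∷_)
open import Data.List.Relation.Unary.Unique.Propositional using (Unique)
open import Data.List.Membership.Propositional using () renaming (_∈_ to _∈ₗ_)
open import Data.List.Membership.Propositional.Properties
  using (∈-∃++; ∈-++⁺ˡ; ∈-++⁺ʳ; ∈-++⁻; ∈-map⁺; ∈-map⁻; ∈-allFin)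
open import Data.Product using (Σ; ∃; _×_; _,_; proj₁; proj₂)
open import Data.Sum using (_⊎_; inj₁; inj₂)
import Data.Sum as Sum
open import Data.Sum.Function.Propositional using (_⊎-⇔_)
open import Data.Empty using (⊥-elim)
open import Function using (_∘_; _⇔_; mk⇔; Equivalence; Injection)
open import Function.Properties.Inverse using (↔⇒↣)
open import Relation.Binary using (Decidable; Symmetric)
open import Relation.Binary.PropositionalEquality
  using (_≡_; _≢_; refl; sym; trans; cong; cong₂; subst; subst₂; ≢-sym; module ≡-Reasoning)
open import Relation.Binary.Construct.Closure.ReflexiveTransitive using (Star; ε; _◅_; _◅◅_; gmap)
open import Relation.Nullary using (¬_; Dec; yes; no; does; ¬?; _⊎-dec_)
open import Relation.Nullary.Decidable using (dec-true; dec-false; does-⇔; decidable-stable)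

module _ {n : ℕ} {E : Fin n → Fin n → Set}
         (E? : Decidable E) (E-sym : Symmetric E) (E-irrefl : ∀ i → ¬ E i i) where

  fromDecidable : Graph n
  fromDecidable = record
    { adj    = λ i j → does (E? i j)
    ; sym    = λ i j → does-⇔ (mk⇔ E-sym E-sym) (E? i j) (E? j i)
    ; irrefl = λ i → dec-false (E? i i) (E-irrefl i)
    }

  Adj-fromDecidable⁺ : ∀ {i j} → E i j → Adj fromDecidable i j
  Adj-fromDecidable⁺ {i} {j} = dec-true (E? i j)

  Adj-fromDecidable⁻ : ∀ {i j} → Adj fromDecidable i j → E i j
  Adj-fromDecidable⁻ {i} {j} a with E? i j
  ... | yes e = e

  fromDecidable-automorphism : (σ : Permutation′ n) →
    (∀ i j → E (σ ⟨$⟩ʳ i) (σ ⟨$⟩ʳ j) ⇔ E i j) → IsAutomorphism fromDecidable σ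
  fromDecidable-automorphism σ σ-preserves i j =
    does-⇔ (σ-preserves i j) (E? (σ ⟨$⟩ʳ i) (σ ⟨$⟩ʳ j)) (E? i j)

module _ {n : ℕ} {P : Fin n → Set} (P? : ∀ x → Dec (P x)) where

  decSubset : Subset n
  decSubset = tabulate (does ∘ P?)

  ∈-decSubset⁺ : ∀ {x} → P x → x ∈ decSubset
  ∈-decSubset⁺ {x} Px =
    lookup⇒[]= x decSubset (trans (lookup∘tabulate (does ∘ P?) x) (dec-true (P? x) Px))

  ∈-decSubset⁻ : ∀ {x} → x ∈ decSubset → P x
  ∈-decSubset⁻ {x} x∈ = from-does (trans (sym (lookup∘tabulate (does ∘ P?) x)) ([]=⇒lookup x∈))
    where
    from-does : does (P? x) ≡ true → P x
    from-does _ with P? x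
    ... | yes Px = Px

module _ {n : ℕ} (G : Graph n) where

  IsFort : (Fin n → Set) → Set
  IsFort F = ∀ u v → ¬ F u → F v → Adj G u v → ∃ λ w → F w × Adj G u w × w ≢ v

  module _ {F : Fin n → Set} {T : Subset n} (fort : IsFort F) (disjoint : ∀ x → x ∈ T → ¬ F x) where

    IsFort⇒¬Blue : ∀ {v} → Blue G T v → ¬ F v
    IsFort⇒¬Blue (initial v∈T) = disjoint _ v∈T
    IsFort⇒¬Blue (force {u} {v} blue-u u~v rest) Fv with fort u v (IsFort⇒¬Blue blue-u) Fv u~v
    ... | w , Fw , u~w , w≢v = IsFort⇒¬Blue (rest w u~w w≢v) Fw

    IsFort⇒¬IsZeroForcingSet : ∀ {x} → F x → ¬ IsZeroForcingSet G T
    IsFort⇒¬IsZeroForcingSet Fx zfs = IsFort⇒¬Blue (zfs _) Fx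

  pair-fort : ∀ {x y} → x ≢ y → (∀ u → u ≢ x → u ≢ y → Adj G u x ⇔ Adj G u y) →
              IsFort (λ z → z ≡ x ⊎ z ≡ y)
  pair-fort x≢y twins u _ u∉F (inj₁ refl) u~x =
    _ , inj₂ refl , Equivalence.to (twins u (u∉F ∘ inj₁) (u∉F ∘ inj₂)) u~x , ≢-sym x≢y
  pair-fort x≢y twins u _ u∉F (inj₂ refl) u~y =
    _ , inj₁ refl , Equivalence.from (twins u (u∉F ∘ inj₁) (u∉F ∘ inj₂)) u~y , x≢y

Unique-⊆⇒length≤ : ∀ {A : Set} {xs ys : List A} →
                   Unique xs → (∀ {x} → x ∈ₗ xs → x ∈ₗ ys) → length xs ≤ length ys
Unique-⊆⇒length≤ {xs = []} _ _ = z≤n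
Unique-⊆⇒length≤ {xs = x ∷ xs} (x∉xs ∷ unique) xs⊆ys with ∈-∃++ (xs⊆ys (here refl))
... | ys₁ , ys₂ , refl =
  subst (suc (length xs) ≤_) (sym (length-++-sucʳ ys₁ x ys₂))
        (s≤s (Unique-⊆⇒length≤ unique xs⊆ys₁++ys₂))
  where
  xs⊆ys₁++ys₂ : ∀ {y} → y ∈ₗ xs → y ∈ₗ ys₁ ++ ys₂
  xs⊆ys₁++ys₂ y∈xs with ∈-++⁻ ys₁ (xs⊆ys (there y∈xs))
  ... | inj₁ y∈ys₁ = ∈-++⁺ˡ y∈ys₁
  ... | inj₂ (here refl) = ⊥-elim (lookupAll x∉xs y∈xs refl)
  ... | inj₂ (there y∈ys₂) = ∈-++⁺ʳ ys₁ y∈ys₂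

transpose-maps : ∀ {n} (i j : Fin n) → transpose i j ⟨$⟩ʳ i ≡ j
transpose-maps i j rewrite dec-true (i ≟ i) refl = refl

-- Complete graphs

private
  _≢?_ : ∀ {n} → Decidable {A = Fin n} _≢_
  i ≢? j = ¬? (i ≟ j)

  ≢-irreflexive : ∀ {n} (i : Fin n) → ¬ i ≢ i
  ≢-irreflexive i i≢i = i≢i refl

complete : ∀ n → Graph n
complete n = fromDecidable _≢?_ ≢-sym ≢-irreflexive

complete-Adj⁺ : ∀ {n} {i j : Fin n} → i ≢ j → Adj (complete n) i j
complete-Adj⁺ = Adj-fromDecidable⁺ _≢?_ ≢-sym ≢-irreflexive

complete-connected : ∀ {n} → Connected (complete n)
complete-connected u v with u ≟ v
... | yes refl = ε
... | no u≢v = complete-Adj⁺ u≢v ◅ ε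

complete-vertexTransitive : ∀ {n} → VertexTransitive (complete n)
complete-vertexTransitive v₁ v₂ =
  σ , fromDecidable-automorphism _≢?_ ≢-sym ≢-irreflexive σ σ-preserves-≢ , transpose-maps v₁ v₂
  where
  σ = transpose v₁ v₂
  σ-preserves-≢ : ∀ i j → σ ⟨$⟩ʳ i ≢ σ ⟨$⟩ʳ j ⇔ i ≢ j
  σ-preserves-≢ i j = mk⇔ (_∘ cong (σ ⟨$⟩ʳ_)) (_∘ Injection.injective (↔⇒↣ σ))

x≢y⇒x∈∁⁅y⁆ : ∀ {n} {x y : Fin n} → x ≢ y → x ∈ ∁ ⁅ y ⁆
x≢y⇒x∈∁⁅y⁆ x≢y = x∉p⇒x∈∁p (x≢y ∘ x∈⁅y⁆⇒x≡y _)

x∉∁⁅x⁆ : ∀ {n} (x : Fin n) → x ∉ ∁ ⁅ x ⁆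
x∉∁⁅x⁆ x x∈ = x∈∁p⇒x∉p x∈ (x∈⁅x⁆ x)

module _ {k : ℕ} where

  private
    K = complete (2 + k)

  private
    another : (v : Fin (2 + k)) → ∃ λ u → u ≢ v
    another zero = suc zero , λ ()
    another (suc _) = zero , λ ()

  complete-∁⁅⁆-zeroForcing : ∀ v → IsZeroForcingSet K (∁ ⁅ v ⁆)
  complete-∁⁅⁆-zeroForcing v x with x ≟ v
  ... | no x≢v = initial (x≢y⇒x∈∁⁅y⁆ x≢v)
  ... | yes refl with another v
  ...   | u , u≢v = force (initial (x≢y⇒x∈∁⁅y⁆ u≢v)) (complete-Adj⁺ u≢v)
                            λ w _ w≢v → initial (x≢y⇒x∈∁⁅y⁆ w≢v)

  complete-minimal⇒∁⁅⁆ : ∀ {S} → IsMinimalZeroForcingSet K S → ∃ λ a → S ≡ ∁ ⁅ a ⁆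
  complete-minimal⇒∁⁅⁆ {S} (zfs , minimal) with any? (λ x → ¬? (x ∈? S))
  ... | no none =
    ⊥-elim (minimal (∁ ⁅ zero ⁆) ((λ _ → everything _) , zero , everything zero , x∉∁⁅x⁆ zero)
                    (complete-∁⁅⁆-zeroForcing zero))
    where
    everything : ∀ x → x ∈ S
    everything x = decidable-stable (x ∈? S) (λ x∉S → none (x , x∉S))
  ... | yes (a , a∉S) = a , ⊆-antisym S⊆∁⁅a⁆ ∁⁅a⁆⊆S
    where
    S⊆∁⁅a⁆ : S ⊆ ∁ ⁅ a ⁆
    S⊆∁⁅a⁆ x∈S = x≢y⇒x∈∁⁅y⁆ λ { refl → a∉S x∈S }
    ∁⁅a⁆⊆S : ∁ ⁅ a ⁆ ⊆ S
    ∁⁅a⁆⊆S {b} b∈∁⁅a⁆ = decidable-stable (b ∈? S) λ b∉S →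
      IsFort⇒¬IsZeroForcingSet K (pair-fort K b≢a twins) (disjoint b∉S) (inj₁ refl) zfs
      where
      b≢a : b ≢ a
      b≢a refl = x∉∁⁅x⁆ b b∈∁⁅a⁆
      twins : ∀ u → u ≢ b → u ≢ a → Adj K u b ⇔ Adj K u a
      twins u u≢b u≢a = mk⇔ (λ _ → complete-Adj⁺ u≢a) (λ _ → complete-Adj⁺ u≢b)
      disjoint : b ∉ S → ∀ x → x ∈ S → ¬ (x ≡ b ⊎ x ≡ a)
      disjoint b∉S x x∈S (inj₁ refl) = b∉S x∈S
      disjoint b∉S x x∈S (inj₂ refl) = a∉S x∈S

  complete-AtMostMinZFS : AtMostMinZFS K (2 + k)
  complete-AtMostMinZFS Ss unique minimal =
    subst (length Ss ≤_) (trans (length-map ∁⁅_⁆ (allFin _)) (length-tabulate (λ i → i)))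
          (Unique-⊆⇒length≤ unique Ss⊆co-singletons)
    where
    ∁⁅_⁆ : Fin (2 + k) → Subset (2 + k)
    ∁⁅ a ⁆ = ∁ ⁅ a ⁆
    Ss⊆co-singletons : ∀ {S} → S ∈ₗ Ss → S ∈ₗ map ∁⁅_⁆ (allFin _)
    Ss⊆co-singletons S∈Ss with complete-minimal⇒∁⁅⁆ (lookupAll minimal S∈Ss)
    ... | a , refl = ∈-map⁺ ∁⁅_⁆ (∈-allFin a)

-- Rotations of Fin (suc n)

module _ {n : ℕ} where

  private
    m = suc n

  rotate : ℕ → Fin m → Fin m
  rotate k x = (k + toℕ x) mod m

  toℕ-rotate : ∀ k x → toℕ (rotate k x) ≡ (k + toℕ x) % m
  toℕ-rotate k x = toℕ-fromℕ< (m%n<n (k + toℕ x) m)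

  rotate-+ : ∀ a b x → rotate a (rotate b x) ≡ rotate (a + b) x
  rotate-+ a b x = toℕ-injective (begin
    toℕ (rotate a (rotate b x))       ≡⟨ toℕ-rotate a (rotate b x) ⟩
    (a + toℕ (rotate b x)) % m        ≡⟨ cong (λ y → (a + y) % m) (toℕ-rotate b x) ⟩
    (a + (b + toℕ x) % m) % m         ≡⟨ %-distribˡ-+ a _ m ⟩
    (a % m + (b + toℕ x) % m % m) % m ≡⟨ cong (λ y → (a % m + y) % m) (m%n%n≡m%n (b + toℕ x) m) ⟩
    (a % m + (b + toℕ x) % m) % m     ≡⟨ %-distribˡ-+ a (b + toℕ x) m ⟨
    (a + (b + toℕ x)) % m             ≡⟨ cong (_% m) (+-assoc a b (toℕ x)) ⟨
    (a + b + toℕ x) % m               ≡⟨ toℕ-rotate (a + b) x ⟨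
    toℕ (rotate (a + b) x)            ∎)
    where open ≡-Reasoning

  rotate-comm : ∀ a b x → rotate a (rotate b x) ≡ rotate b (rotate a x)
  rotate-comm a b x =
    trans (rotate-+ a b x) (trans (cong (λ k → rotate k x) (+-comm a b)) (sym (rotate-+ b a x)))

  rotate-zero : ∀ x → rotate 0 x ≡ x
  rotate-zero x = toℕ-injective (trans (toℕ-rotate 0 x) (m<n⇒m%n≡m (toℕ<n x)))

  rotate-periodic : ∀ k j x → rotate (k + j * m) x ≡ rotate k x
  rotate-periodic k j x = toℕ-injective (begin
    toℕ (rotate (k + j * m) x) ≡⟨ toℕ-rotate (k + j * m) x ⟩
    (k + j * m + toℕ x) % m    ≡⟨ cong (_% m) (+-assoc k (j * m) (toℕ x)) ⟩
    (k + (j * m + toℕ x)) % m  ≡⟨ cong (λ y → (k + y) % m) (+-comm (j * m) (toℕ x)) ⟩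
    (k + (toℕ x + j * m)) % m  ≡⟨ cong (_% m) (+-assoc k (toℕ x) (j * m)) ⟨
    (k + toℕ x + j * m) % m    ≡⟨ [m+kn]%n≡m%n (k + toℕ x) j m ⟩
    (k + toℕ x) % m            ≡⟨ toℕ-rotate k x ⟨
    toℕ (rotate k x)           ∎)
    where open ≡-Reasoning

  rotate-inverseʳ : ∀ j x → rotate j (rotate (j * n) x) ≡ x
  rotate-inverseʳ j x = begin
    rotate j (rotate (j * n) x) ≡⟨ rotate-+ j (j * n) x ⟩
    rotate (j + j * n) x        ≡⟨ cong (λ k → rotate k x) (*-suc j n) ⟨
    rotate (0 + j * m) x        ≡⟨ rotate-periodic 0 j x ⟩
    rotate 0 x                  ≡⟨ rotate-zero x ⟩
    x                           ∎
    where open ≡-Reasoning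

  rotate-inverseˡ : ∀ j x → rotate (j * n) (rotate j x) ≡ x
  rotate-inverseˡ j x = trans (rotate-comm (j * n) j x) (rotate-inverseʳ j x)

  rotate-injective : ∀ j {x y} → rotate j x ≡ rotate j y → x ≡ y
  rotate-injective j {x} {y} eq =
    trans (sym (rotate-inverseˡ j x)) (trans (cong (rotate (j * n)) eq) (rotate-inverseˡ j y))

  rotation : ℕ → Permutation′ m
  rotation j = permutation (rotate j) (rotate (j * n)) (rotate-inverseʳ j) (rotate-inverseˡ j)

  rotate-from-to : ∀ x y → rotate (toℕ y + (m ∸ toℕ x)) x ≡ y
  rotate-from-to x y = toℕ-injective (begin
    toℕ (rotate (toℕ y + (m ∸ toℕ x)) x) ≡⟨ toℕ-rotate (toℕ y + (m ∸ toℕ x)) x ⟩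
    (toℕ y + (m ∸ toℕ x) + toℕ x) % m    ≡⟨ cong (_% m) (+-assoc (toℕ y) _ _) ⟩
    (toℕ y + (m ∸ toℕ x + toℕ x)) % m    ≡⟨ cong (λ k → (toℕ y + k) % m) (m∸n+n≡m (<⇒≤ (toℕ<n x))) ⟩
    (toℕ y + m) % m                      ≡⟨ [m+n]%n≡m%n (toℕ y) m ⟩
    toℕ y % m                            ≡⟨ m<n⇒m%n≡m (toℕ<n y) ⟩
    toℕ y                                ∎)
    where open ≡-Reasoning

  rotate-fixed : ∀ {a} x → a < m → rotate a x ≡ x → a ≡ 0
  rotate-fixed {a} x a<m fixed = begin
    a                                     ≡⟨ m<n⇒m%n≡m a<m ⟨
    a % m                                 ≡⟨ cong (_% m) (+-identityʳ a) ⟨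
    (a + 0) % m                           ≡⟨ toℕ-rotate a zero ⟨
    toℕ (rotate a zero)                   ≡⟨ cong (toℕ ∘ rotate a) (rotate-from-to x zero) ⟨
    toℕ (rotate a (rotate (m ∸ toℕ x) x)) ≡⟨ cong toℕ (rotate-comm a (m ∸ toℕ x) x) ⟩
    toℕ (rotate (m ∸ toℕ x) (rotate a x)) ≡⟨ cong (toℕ ∘ rotate (m ∸ toℕ x)) fixed ⟩
    toℕ (rotate (m ∸ toℕ x) x)            ≡⟨ cong toℕ (rotate-from-to x zero) ⟩
    0                                     ∎
    where open ≡-Reasoning

even-or-odd : ∀ n → ∃ λ a → n ≡ a + a ⊎ n ≡ suc (a + a)
even-or-odd zero = 0 , inj₁ refl
even-or-odd (suc n) with even-or-odd n
... | a , inj₁ n≡a+a = a , inj₂ (cong suc n≡a+a)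
... | a , inj₂ n≡1+a+a = suc a , inj₁ (cong suc (trans n≡1+a+a (sym (+-suc a a))))

rotate-toℕ : ∀ {n} (r : Fin (suc n)) → rotate (toℕ r) zero ≡ r
rotate-toℕ r = toℕ-injective (trans (toℕ-rotate (toℕ r) zero)
                                    (trans (cong (_% _) (+-identityʳ (toℕ r))) (m<n⇒m%n≡m (toℕ<n r))))

-- An odd residue r is reached as r + m, which is even.
rotate-even-surjective : ∀ {h} (r : Fin (suc (h + h))) → ∃ λ j → rotate (j + j) zero ≡ r
rotate-even-surjective {h} r with even-or-odd (toℕ r)
... | a , inj₁ r≡a+a = a , trans (cong (λ i → rotate i zero) (sym r≡a+a)) (rotate-toℕ r)
... | a , inj₂ r≡1+a+a = a + suc h , (begin
  rotate ((a + suc h) + (a + suc h)) zero   ≡⟨ cong (λ i → rotate i zero) (double a h) ⟩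
  rotate (suc (a + a) + 1 * suc (h + h)) zero ≡⟨ rotate-periodic (suc (a + a)) 1 zero ⟩
  rotate (suc (a + a)) zero                 ≡⟨ cong (λ i → rotate i zero) r≡1+a+a ⟨
  rotate (toℕ r) zero                       ≡⟨ rotate-toℕ r ⟩
  r                                         ∎)
  where
  open ≡-Reasoning
  double : ∀ a h → (a + suc h) + (a + suc h) ≡ suc (a + a) + 1 * suc (h + h)
  double = solve-∀

-- Cycles

module _ {k : ℕ} where

  next prev : Fin (2 + k) → Fin (2 + k)
  next = rotate 1
  prev = rotate (1 * suc k)

  private
    CycleStep : Fin (2 + k) → Fin (2 + k) → Set
    CycleStep r s = s ≡ next r ⊎ r ≡ next s

    cycleStep? : Decidable CycleStep
    cycleStep? r s = (s ≟ next r) ⊎-dec (r ≟ next s)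

    next-irreflexive : ∀ r → ¬ CycleStep r r
    next-irreflexive r (inj₁ r≡next-r) with rotate-fixed r (s≤s (s≤s z≤n)) (sym r≡next-r)
    ... | ()
    next-irreflexive r (inj₂ r≡next-r) = next-irreflexive r (inj₁ r≡next-r)

  cycle : Graph (2 + k)
  cycle = fromDecidable cycleStep? Sum.swap next-irreflexive

  cycle-Adj-next : ∀ r → Adj cycle r (next r)
  cycle-Adj-next r = Adj-fromDecidable⁺ cycleStep? Sum.swap next-irreflexive {r} (inj₁ refl)

  cycle-Adj-prev : ∀ r → Adj cycle r (prev r)
  cycle-Adj-prev r =
    Adj-fromDecidable⁺ cycleStep? Sum.swap next-irreflexive {r} {prev r} (inj₂ (sym (rotate-inverseʳ 1 r)))

  cycle-neighbours : ∀ {r s} → Adj cycle r s → s ≡ next r ⊎ s ≡ prev r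
  cycle-neighbours {r} {s} r~s with Adj-fromDecidable⁻ cycleStep? Sum.swap next-irreflexive r~s
  ... | inj₁ s≡next-r = inj₁ s≡next-r
  ... | inj₂ r≡next-s = inj₂ (trans (sym (rotate-inverseˡ 1 s)) (cong prev (sym r≡next-s)))

  cycle-vertexTransitive : VertexTransitive cycle
  cycle-vertexTransitive v₁ v₂ =
    rotation j , fromDecidable-automorphism cycleStep? Sum.swap next-irreflexive (rotation j) rotation-preserves ,
    rotate-from-to v₁ v₂
    where
    j = toℕ v₂ + (2 + k ∸ toℕ v₁)
    ≡-rotate⇔ : ∀ {x y} → rotate j x ≡ rotate j y ⇔ x ≡ y
    ≡-rotate⇔ = mk⇔ (rotate-injective j) (cong (rotate j))
    next-rotate : ∀ x → next (rotate j x) ≡ rotate j (next x)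
    next-rotate x = rotate-comm 1 j x
    rotation-preserves : ∀ r s → CycleStep (rotate j r) (rotate j s) ⇔ CycleStep r s
    rotation-preserves r s rewrite next-rotate r | next-rotate s = ≡-rotate⇔ ⊎-⇔ ≡-rotate⇔

  cycle-connected : Connected cycle
  cycle-connected x y = subst (Star (Adj cycle) x) (rotate-from-to x y) (walk (toℕ y + (2 + k ∸ toℕ x)))
    where
    walk : ∀ j → Star (Adj cycle) x (rotate j x)
    walk zero = subst (Star (Adj cycle) x) (sym (rotate-zero x)) ε
    walk (suc j) = walk j ◅◅ subst (Adj cycle (rotate j x)) (rotate-+ 1 j x) (cycle-Adj-next (rotate j x)) ◅ ε

  cycle-has-neighbour : ∀ r → ∃ (Adj cycle r)
  cycle-has-neighbour r = next r , cycle-Adj-next r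

  next≢prev : 1 ≤ k → (r : Fin (2 + k)) → next r ≢ prev r
  next≢prev 1≤k r eq with rotate-fixed r (s≤s (s≤s 1≤k))
                            (trans (sym (rotate-+ 1 1 r)) (trans (cong next eq) (rotate-inverseʳ 1 r)))
  ... | ()

  cycle-another-neighbour : 1 ≤ k → ∀ {p q} → Adj cycle p q → ∃ λ q′ → q′ ≢ q × Adj cycle p q′
  cycle-another-neighbour 1≤k {p} {q} p~q with cycle-neighbours {p} {q} p~q
  ... | inj₁ refl = prev p , next≢prev 1≤k p ∘ sym , cycle-Adj-prev p
  ... | inj₂ refl = next p , next≢prev 1≤k p , cycle-Adj-next p

-- Blow-ups

module Copies (m k : ℕ) where

  class : Fin (m * k) → Fin m
  class x = proj₁ (remQuot {m} k x)

  copy : Fin (m * k) → Fin k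
  copy x = proj₂ (remQuot {m} k x)

  class-combine : ∀ (r : Fin m) (b : Fin k) → class (combine r b) ≡ r
  class-combine r b = cong proj₁ (remQuot-combine r b)

  copy-combine : ∀ (r : Fin m) (b : Fin k) → copy (combine r b) ≡ b
  copy-combine r b = cong proj₂ (remQuot-combine r b)

  combine-class-copy : ∀ x → combine (class x) (copy x) ≡ x
  combine-class-copy = combine-remQuot {m} k

  combineₚ : Permutation′ m → Permutation′ k → Permutation′ (m * k)
  combineₚ σ τ =
    permutation (act σ τ) (act (flip σ) (flip τ)) (act-inverse σ τ) (act-inverse (flip σ) (flip τ))
    where
    act : Permutation′ m → Permutation′ k → Fin (m * k) → Fin (m * k)
    act σ τ x = combine (σ ⟨$⟩ʳ class x) (τ ⟨$⟩ʳ copy x)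
    act-inverse : ∀ σ τ x → act σ τ (act (flip σ) (flip τ) x) ≡ x
    act-inverse σ τ x =
      trans (cong₂ (λ r b → combine (σ ⟨$⟩ʳ r) (τ ⟨$⟩ʳ b)) (class-combine _ _) (copy-combine _ _))
            (trans (cong₂ combine (inverseʳ σ) (inverseʳ τ)) (combine-class-copy x))

-- The lexicographic product G[K̄ₖ]; vertex x is copy (copy x) of vertex (class x) of G.
blowUp : ∀ {m} → Graph m → (k : ℕ) → Graph (m * k)
blowUp {m} G k = record
  { adj    = λ x y → adj G (class x) (class y)
  ; sym    = λ x y → Graph.sym G (class x) (class y)
  ; irrefl = λ x → irrefl G (class x)
  }
  where open Copies m k

module _ {m : ℕ} {G : Graph m} {k : ℕ} where

  open Copies m k

  blowUp-connected : Connected G → (∀ r → ∃ (Adj G r)) → Connected (blowUp G k)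
  blowUp-connected connected has-neighbour u v with has-neighbour (class v)
  ... | r , v~r = subst (λ w → Star (Adj (blowUp G k)) w v) (combine-class-copy u)
                    (gmap (λ p → combine p b) lift (connected (class u) r) ◅◅ last ◅ ε)
    where
    b = copy u
    lift : ∀ {p q} → Adj G p q → Adj G (class (combine p b)) (class (combine q b))
    lift {p} {q} = subst₂ (Adj G) (sym (class-combine p b)) (sym (class-combine q b))
    last : Adj G (class (combine r b)) (class v)
    last = subst (λ p → Adj G p (class v)) (sym (class-combine r b))
                 (trans (Graph.sym G r (class v)) v~r)

  blowUp-vertexTransitive : VertexTransitive G → VertexTransitive (blowUp G k)
  blowUp-vertexTransitive transitive x₁ x₂ with transitive (class x₁) (class x₂)
  ... | σ , σ-automorphism , σx₁≡x₂ = combineₚ σ τ , automorphism , maps-x₁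
    where
    τ = transpose (copy x₁) (copy x₂)
    automorphism : IsAutomorphism (blowUp G k) (combineₚ σ τ)
    automorphism x y = trans (cong₂ (adj G) (class-combine _ _) (class-combine _ _))
                             (σ-automorphism (class x) (class y))
    maps-x₁ : combineₚ σ τ ⟨$⟩ʳ x₁ ≡ x₂
    maps-x₁ = trans (cong₂ combine σx₁≡x₂ (transpose-maps (copy x₁) (copy x₂))) (combine-class-copy x₂)

module _ {m : ℕ} {G : Graph m} {k : ℕ} {F : Fin (m * k) → Set} where

  open Copies m k

  transversal-fort : (∀ {p q} → Adj G p q → ∃ λ q′ → q′ ≢ q × Adj G p q′) →
                     (∀ q → ∃ λ x → class x ≡ q × F x) → IsFort (blowUp G k) F
  transversal-fort another-neighbour meets u v _ _ u~v with another-neighbour u~v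
  ... | q′ , q′≢class-v , u~q′ with meets q′
  ...   | w , refl , Fw = w , Fw , u~q′ , λ { refl → q′≢class-v refl }

module Twins (m : ℕ) where

  open Copies m 2

  twin : Fin (m * 2) → Fin (m * 2)
  twin x = combine (class x) (opposite (copy x))

  class-twin : ∀ x → class (twin x) ≡ class x
  class-twin x = class-combine (class x) (opposite (copy x))

  copy-twin≢ : ∀ x → copy (twin x) ≢ copy x
  copy-twin≢ x copy-twin-x≡copy-x =
    opposite-≢ (copy x) (trans (sym (copy-combine (class x) _)) copy-twin-x≡copy-x)
    where
    opposite-≢ : (b : Fin 2) → opposite b ≢ b
    opposite-≢ zero ()
    opposite-≢ (suc zero) ()

  twin≢ : ∀ x → twin x ≢ x
  twin≢ x = copy-twin≢ x ∘ cong copy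

  same-class⇒≡⊎twin : ∀ {x y} → class y ≡ class x → y ≡ x ⊎ y ≡ twin x
  same-class⇒≡⊎twin {x} {y} class-y≡class-x with copy y ≟ copy x
  ... | yes copy-y≡copy-x = inj₁ (from-coordinates copy-y≡copy-x)
    where
    from-coordinates : copy y ≡ copy x → y ≡ x
    from-coordinates eq = trans (sym (combine-class-copy y))
                                (trans (cong₂ combine class-y≡class-x eq) (combine-class-copy x))
  ... | no copy-y≢copy-x = inj₂ (trans (sym (combine-class-copy y))
                                       (cong₂ combine class-y≡class-x (other-bit _ _ copy-y≢copy-x)))
    where
    other-bit : (a b : Fin 2) → a ≢ b → a ≡ opposite b
    other-bit zero zero a≢b = ⊥-elim (a≢b refl)
    other-bit zero (suc zero) _ = refl
    other-bit (suc zero) zero _ = refl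
    other-bit (suc zero) (suc zero) a≢b = ⊥-elim (a≢b refl)

  module _ {G : Graph m} where

    twin-fort : ∀ x → IsFort (blowUp G 2) (λ z → z ≡ x ⊎ z ≡ twin x)
    twin-fort x = pair-fort (blowUp G 2) (≢-sym (twin≢ x)) λ u _ _ →
      mk⇔ (subst (Adj G (class u)) (sym (class-twin x))) (subst (Adj G (class u)) (class-twin x))

  module _ (G : Graph m) (S : Subset (m * 2)) where

    FullClass : Fin m → Set
    FullClass q = ∀ x → class x ≡ q → Blue (blowUp G 2) S x

    FullClass-by-force : ∀ {u z p q} → class u ≡ p → class z ≡ q →
                         Blue (blowUp G 2) S u → Blue (blowUp G 2) S z → Adj G p q →
                         (∀ p′ → Adj G p p′ → p′ ≢ q → FullClass p′) → FullClass q
    FullClass-by-force {u} {z} refl refl blue-u blue-z u~z others x x∈class-z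
      with same-class⇒≡⊎twin x∈class-z
    ... | inj₁ refl = blue-z
    ... | inj₂ refl = force blue-u (subst (Adj G (class u)) (sym (class-twin z)) u~z) rest
      where
      rest : ∀ w → Adj (blowUp G 2) u w → w ≢ twin z → Blue (blowUp G 2) S w
      rest w u~w w≢twin-z with class w ≟ class z
      ... | no class-w≢class-z = others (class w) u~w class-w≢class-z w refl
      ... | yes class-w≡class-z with same-class⇒≡⊎twin class-w≡class-z
      ...   | inj₁ refl = blue-z
      ...   | inj₂ refl = ⊥-elim (w≢twin-z refl)

binaryVectors : ∀ n → List (Vec (Fin 2) n)
binaryVectors zero = [] ∷ []
binaryVectors (suc n) = map (zero ∷_) (binaryVectors n) ++ map (suc zero ∷_) (binaryVectors n)

length-binaryVectors : ∀ n → length (binaryVectors n) ≡ 2 ^ n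
length-binaryVectors zero = refl
length-binaryVectors (suc n) = begin
  length (map (zero ∷_) vs ++ map (suc zero ∷_) vs)         ≡⟨ length-++ (map (zero ∷_) vs) ⟩
  length (map (zero ∷_) vs) + length (map (suc zero ∷_) vs) ≡⟨ cong₂ _+_ (length-map _ vs) (length-map _ vs) ⟩
  length vs + length vs                                     ≡⟨ cong (λ l → l + l) (length-binaryVectors n) ⟩
  2 ^ n + 2 ^ n                                             ≡⟨ cong (2 ^ n +_) (+-identityʳ (2 ^ n)) ⟨
  2 ^ suc n                                                 ∎
  where
  open ≡-Reasoning
  vs = binaryVectors n

binaryVectors-unique : ∀ n → Unique (binaryVectors n)
binaryVectors-unique zero = [] ∷ []
binaryVectors-unique (suc n) =
  Unique.++⁺ (Unique.map⁺ Vec.∷-injectiveʳ unique) (Unique.map⁺ Vec.∷-injectiveʳ unique) disjoint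
  where
  unique = binaryVectors-unique n
  disjoint : Disjoint (map (zero ∷_) (binaryVectors n)) (map (suc zero ∷_) (binaryVectors n))
  disjoint (v∈₀ , v∈₁) with ∈-map⁻ (zero ∷_) v∈₀ | ∈-map⁻ (suc zero ∷_) v∈₁
  ... | _ , _ , refl | _ , _ , ()

-- The doubled odd cycle

module DoubledOddCycle (t : ℕ) where

  m : ℕ
  m = suc (suc t + suc t)

  private
    1≤t+1+t : 1 ≤ t + suc t
    1≤t+1+t = ≤-trans (s≤s z≤n) (m≤n+m (suc t) t)

  3≤m : 3 ≤ m
  3≤m = s≤s (s≤s 1≤t+1+t)

  t≤m*2 : t ≤ m * 2
  t≤m*2 = ≤-trans (m≤m+n t (suc t)) (≤-trans (n≤1+n _) (≤-trans (n≤1+n _) (m≤m*n m 2)))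

  open Copies m 2
  open Twins m

  C : Graph m
  C = cycle {t + suc t}

  graph : Graph (m * 2)
  graph = blowUp C 2

  connected : Connected graph
  connected = blowUp-connected {G = C} {k = 2} cycle-connected (cycle-has-neighbour {t + suc t})

  vertexTransitive : VertexTransitive graph
  vertexTransitive = blowUp-vertexTransitive {G = C} {k = 2} cycle-vertexTransitive

  Choice : Set
  Choice = Vec (Fin 2) (m ∸ 1)

  -- class zero is taken whole; its entry of pick is irrelevant
  pick : Choice → Fin m → Fin 2
  pick c zero = zero
  pick c (suc r) = lookup c r

  InForcingSet : Choice → Fin (m * 2) → Set
  InForcingSet c x = class x ≡ zero ⊎ copy x ≡ pick c (class x)

  inForcingSet? : ∀ c x → Dec (InForcingSet c x)
  inForcingSet? c x = (class x ≟ zero) ⊎-dec (copy x ≟ pick c (class x))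

  forcingSet : Choice → Subset (m * 2)
  forcingSet c = decSubset (inForcingSet? c)

  chosen : Choice → Fin m → Fin (m * 2)
  chosen c q = combine q (pick c q)

  class-chosen : ∀ c q → class (chosen c q) ≡ q
  class-chosen c q = class-combine q (pick c q)

  chosen∈forcingSet : ∀ c q → chosen c q ∈ forcingSet c
  chosen∈forcingSet c q =
    ∈-decSubset⁺ (inForcingSet? c) (inj₂ (trans (copy-combine q _) (cong (pick c) (sym (class-chosen c q)))))

  twin∉forcingSet : ∀ {c x} → x ∈ forcingSet c → class x ≢ zero → twin x ∉ forcingSet c
  twin∉forcingSet {c} {x} x∈S class-x≢0 twin-x∈S
    with ∈-decSubset⁻ (inForcingSet? c) x∈S | ∈-decSubset⁻ (inForcingSet? c) twin-x∈S
  ... | inj₁ class-x≡0 | _ = class-x≢0 class-x≡0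
  ... | _ | inj₁ class-twin-x≡0 = class-x≢0 (trans (sym (class-twin x)) class-twin-x≡0)
  ... | inj₂ copy-x≡pick | inj₂ copy-twin-x≡pick =
    copy-twin≢ x (trans copy-twin-x≡pick (trans (cong (pick c) (class-twin x)) (sym copy-x≡pick)))

  module _ (c : Choice) where

    private
      FullClass′ = FullClass C (forcingSet c)

    FullClass-even : ∀ j → FullClass′ (rotate (j + j) zero)
    FullClass-even zero x class-x≡0 =
      initial (∈-decSubset⁺ (inForcingSet? c) (inj₁ (trans class-x≡0 (rotate-zero zero))))
    FullClass-even (suc j) = subst FullClass′ next²r≡
      (FullClass-by-force C (forcingSet c) (class-chosen c (next r)) (class-chosen c (next (next r)))
        (initial (chosen∈forcingSet c (next r))) (initial (chosen∈forcingSet c (next (next r))))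
        (cycle-Adj-next (next r)) others)
      where
      r = rotate (j + j) zero
      next²r≡ : next (next r) ≡ rotate (suc j + suc j) zero
      next²r≡ = trans (cong next (rotate-+ 1 (j + j) zero))
                      (trans (rotate-+ 1 (suc (j + j)) zero) (cong (λ i → rotate (suc i) zero) (sym (+-suc j j))))
      others : ∀ p → Adj cycle (next r) p → p ≢ next (next r) → FullClass′ p
      others p next-r~p p≢ with cycle-neighbours {r = next r} {s = p} next-r~p
      ... | inj₁ p≡ = ⊥-elim (p≢ p≡)
      ... | inj₂ p≡ = subst FullClass′ (trans (sym (rotate-inverseˡ 1 r)) (sym p≡)) (FullClass-even j)

    forcingSet-zeroForcing : IsZeroForcingSet graph (forcingSet c)
    forcingSet-zeroForcing v with rotate-even-surjective {suc t} (class v)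
    ... | j , reaches-v = FullClass-even j v (sym reaches-v)

    forcingSet-minimal : IsMinimalZeroForcingSet graph (forcingSet c)
    forcingSet-minimal = forcingSet-zeroForcing , no-proper-subset
      where
      no-proper-subset : ∀ T → T ⊂ forcingSet c → ¬ IsZeroForcingSet graph T
      no-proper-subset T (T⊆S , x , x∈S , x∉T) with class x ≟ zero
      ... | no class-x≢0 =
        IsFort⇒¬IsZeroForcingSet graph (twin-fort {G = C} x) disjoint (inj₁ refl)
        where
        disjoint : ∀ y → y ∈ T → ¬ (y ≡ x ⊎ y ≡ twin x)
        disjoint y y∈T (inj₁ refl) = x∉T y∈T
        disjoint y y∈T (inj₂ refl) = twin∉forcingSet {c} x∈S class-x≢0 (T⊆S y∈T)
      ... | yes class-x≡0 =
        IsFort⇒¬IsZeroForcingSet graph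
          (transversal-fort {G = C} {k = 2} (λ {p} {q} → cycle-another-neighbour 1≤t+1+t {p} {q}) meets)
          disjoint (inj₂ refl)
        where
        F : Fin (m * 2) → Set
        F y = y ∉ forcingSet c ⊎ y ≡ x
        meets : ∀ q → ∃ λ y → class y ≡ q × F y
        meets q with q ≟ zero
        ... | yes refl = x , class-x≡0 , inj₂ refl
        ... | no q≢0 =
          twin (chosen c q) , trans (class-twin (chosen c q)) (class-chosen c q) ,
          inj₁ (twin∉forcingSet {c} (chosen∈forcingSet c q) (q≢0 ∘ trans (sym (class-chosen c q))))
        disjoint : ∀ y → y ∈ T → ¬ F y
        disjoint y y∈T (inj₁ y∉S) = y∉S (T⊆S y∈T)
        disjoint y y∈T (inj₂ refl) = x∉T y∈T

  forcingSet-injective : ∀ {c c′} → forcingSet c ≡ forcingSet c′ → c ≡ c′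
  forcingSet-injective {c} {c′} set-c≡set-c′ =
    trans (sym (tabulate∘lookup c)) (trans (tabulate-cong same-pick) (tabulate∘lookup c′))
    where
    same-pick : ∀ i → lookup c i ≡ lookup c′ i
    same-pick i
      with ∈-decSubset⁻ (inForcingSet? c′)
             (subst (chosen c (suc i) ∈_) set-c≡set-c′ (chosen∈forcingSet c (suc i)))
    ... | inj₁ class≡0 with () ← trans (sym (class-chosen c (suc i))) class≡0
    ... | inj₂ copy≡pick = trans (sym (copy-combine (suc i) _))
                                 (trans copy≡pick (cong (pick c′) (class-chosen c (suc i))))

  AtLeastMinZFS-2^[m∸1] : AtLeastMinZFS graph (2 ^ (m ∸ 1))
  AtLeastMinZFS-2^[m∸1] =
    map forcingSet choices , Unique.map⁺ forcingSet-injective (binaryVectors-unique (m ∸ 1)) ,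
    All.map⁺ (All.universal forcingSet-minimal choices) ,
    ≤-reflexive (sym (trans (length-map forcingSet choices) (length-binaryVectors (m ∸ 1))))
    where
    choices = binaryVectors (m ∸ 1)

25^≤16^*2^ : ∀ s → 25 ^ (3 + s) ≤ 16 ^ (3 + s) * 2 ^ (2 + s)
25^≤16^*2^ zero = ≤ᵇ⇒≤ _ _ tt
25^≤16^*2^ (suc s) = begin
  25 * 25 ^ (3 + s)                   ≤⟨ *-monoʳ-≤ 25 (25^≤16^*2^ s) ⟩
  25 * (16 ^ (3 + s) * 2 ^ (2 + s))   ≤⟨ *-monoˡ-≤ (16 ^ (3 + s) * 2 ^ (2 + s)) (≤ᵇ⇒≤ 25 32 tt) ⟩
  32 * (16 ^ (3 + s) * 2 ^ (2 + s))   ≡⟨ regroup (16 ^ (3 + s)) (2 ^ (2 + s)) ⟩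
  16 * 16 ^ (3 + s) * (2 * 2 ^ (2 + s)) ∎
  where
  open ≤-Reasoning
  regroup : ∀ a b → 32 * (a * b) ≡ 16 * a * (2 * b)
  regroup = solve-∀

5^[2m]≤4^[2m]*2^[m∸1] : ∀ {m} → 3 ≤ m → 5 ^ (m * 2) ≤ 4 ^ (m * 2) * 2 ^ (m ∸ 1)
5^[2m]≤4^[2m]*2^[m∸1] {m} (s≤s (s≤s (s≤s {n = s} z≤n))) =
  subst₂ (λ a b → a ≤ b * 2 ^ (m ∸ 1)) (square-base 5) (square-base 4) (25^≤16^*2^ s)
  where
  square-base : ∀ b → (b ^ 2) ^ m ≡ b ^ (m * 2)
  square-base b = trans (^-*-assoc b 2 m) (cong (b ^_) (*-comm 2 m))

proposition2p6 :
    (Σ ℕ λ p → Σ ℕ λ q → (q < p) × ((m : ℕ) → Σ ℕ λ n → Σ (Graph n) λ G →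
        (m ≤ n) × Connected G × VertexTransitive G ×
        Σ ℕ λ k → AtLeastMinZFS G k × (p ^ n ≤ q ^ n * k)))
    ×
    (Σ ℕ λ C → Σ ℕ λ d → ((m : ℕ) → Σ ℕ λ n → Σ (Graph n) λ G →
        (m ≤ n) × Connected G × VertexTransitive G × AtMostMinZFS G (C * n ^ d)))
proposition2p6 =
  (5 , 4 , ≤ᵇ⇒≤ 5 5 tt , λ t → let open DoubledOddCycle t in
     m * 2 , graph , t≤m*2 , connected , vertexTransitive ,
     2 ^ (m ∸ 1) , AtLeastMinZFS-2^[m∸1] , 5^[2m]≤4^[2m]*2^[m∸1] 3≤m) ,
  (1 , 1 , λ t →
     2 + t , complete (2 + t) , m≤n+m t 2 , complete-connected , complete-vertexTransitive ,
     subst (AtMostMinZFS (complete (2 + t))) (sym (trans (*-identityˡ _) (*-identityʳ _))) complete-AtMostMinZFS)
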